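{- For every graph $G$ (possibly with loops), $h(G)=h(B_G)$.
   Context: Graphs are finite, undirected, with no parallel edges and no isolated vertices, possibly with loops. $B_G$ is the graph with vertex set $V\cup V'$, where $V'=\{v':v\in V\}$ is a disjoint copy of $V=V(G)$, containing the edges $v'w$ and $w'v$ for every edge $vw$ of $G$ (so a loop $vv$ yields the single edge $vv'$); $B_G$ is bipartite and loopless. For $A\subseteq V$, $N(A)$ is the set of vertices having a neighbor in $A$ (a looped vertex is its own neighbor). A hunter strategy $(W_t)_{t\ge1}$ gives rabbit territory $R_1=V\setminus W_1$, $R_t=N(R_{t-1})\setminus W_t$; it is winning if $R_T=\emptyset$ for some finite $T$; $h(G)$ is the minimum $k$ such that a winning strategy with $|W_t|\le k$ for all $t$ exists. -}

module Defs where

open import Data.Bool using (Bool; true; false; _∧_)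
open import Data.Nat using (ℕ; zero; suc; _+_; _≤_; _<_)
open import Data.Fin using (Fin; splitAt)
open import Data.Fin.Subset using (Subset; ∣_∣; ⊥; ⊤; _─_)
open import Data.Sum using (inj₁; inj₂)
open import Data.List using (allFin)
open import Data.Bool.ListAction using (any)
open import Data.Vec using (lookup; tabulate)
open import Data.Product using (Σ; ∃; _×_)
open import Relation.Binary.PropositionalEquality using (_≡_)

-- A graph on vertex set Fin n, given by its adjacency relation (loops allowed:
-- adj v v ≡ true means v carries a loop). No parallel edges is automatic.
Adj : ℕ → Set
Adj n = Fin n → Fin n → Bool

Symmetric : ∀ {n} → Adj n → Set
Symmetric {n} adj = ∀ (u v : Fin n) → adj u v ≡ adj v u

NoIsolated : ∀ {n} → Adj n → Set
NoIsolated {n} adj = ∀ (v : Fin n) → ∃ λ (w : Fin n) → adj v w ≡ true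

IsGraph : ∀ {n} → Adj n → Set
IsGraph adj = Symmetric adj × NoIsolated adj

-- N(A): vertices having a neighbour in A (a looped vertex is its own neighbour).
N : ∀ {n} → Adj n → Subset n → Subset n
N {n} adj A = tabulate λ v → any (λ w → lookup A w ∧ adj v w) (allFin n)

-- A hunter strategy: W t is the hunters' shot set at round t+1 (index 0 = round 1).
Strategy : ℕ → Set
Strategy n = ℕ → Subset n

Rabbit : ∀ {n} → Adj n → Strategy n → ℕ → Subset n
Rabbit adj W zero    = ⊤ ─ W zero
Rabbit adj W (suc t) = N adj (Rabbit adj W t) ─ W (suc t)

Winning : ∀ {n} → Adj n → Strategy n → Set
Winning adj W = ∃ λ T → Rabbit adj W T ≡ ⊥

Bounded : ∀ {n} → ℕ → Strategy n → Set
Bounded k W = ∀ t → ∣ W t ∣ ≤ k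

Huntable : ∀ {n} → Adj n → ℕ → Set
Huntable {n} adj k = Σ (Strategy n) λ W → Bounded k W × Winning adj W

IsHuntingNumber : ∀ {n} → Adj n → ℕ → Set
IsHuntingNumber adj k = Huntable adj k × (∀ j → j < k → Huntable adj j → Data.Empty.⊥)
  where import Data.Empty

-- B_G on vertex set Fin (n + n): the first copy is V, the second is V'.
-- v and w' are adjacent iff vw is an edge of G (so a loop vv gives the edge vv').
B : ∀ {n} → Adj n → Adj (n + n)
B {n} adj x y with splitAt n x | splitAt n y
... | inj₁ v | inj₂ w = adj v w
... | inj₂ v | inj₁ w = adj v w
... | inj₁ _ | inj₁ _ = false
... | inj₂ _ | inj₂ _ = false

{-# OPTIONS --safe #-}

-- Every edge of B_G joins the two copies of V, so the neighbourhood in B_G of a set lying on one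
-- copy lies on the other. Hence the rabbit territory in B_G is a pair of territories, one that
-- starts on V and one that starts on V', both switching copies every round, and each evolves
-- exactly as a territory in G under the shots that land on its current copy. A winning strategy
-- on B_G thus yields one on G by keeping only the shots on the first part; conversely a winning
-- strategy on G, finished by round τ, is played against the first part during rounds 0..τ and then
-- replayed against the second part, which by then is no larger than a fresh territory.

module Submission where

open import Defs
open import Data.Nat using (ℕ; zero; suc; _+_; _∸_; _≤_; _≤?_; z≤n; s≤s)
open import Data.Nat.Properties using (≤-trans; ≤-refl; m≤n⇒m≤1+n; m≤m+n; +-comm; +-identityʳ; m+n∸m≡n; <⇒≱)
open import Data.Bool using (Bool; true; false; not; T; if_then_else_)
open import Data.Bool.Properties using (T-≡; T-∧)
open import Data.Fin using (Fin; zero; suc; splitAt; _↑ˡ_; _↑ʳ_)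
open import Data.Fin.Properties using (splitAt-↑ˡ; splitAt-↑ʳ; splitAt⁻¹-↑ˡ; splitAt⁻¹-↑ʳ)
open import Data.Fin.Subset using (Subset; inside; outside; _∈_; _∉_; _⊆_; _─_; ∣_∣; ⊥; ⊤)
open import Data.Fin.Subset.Properties using (⊆-refl; ⊆-trans; ⊆-reflexive; ⊆-antisym; ⊆⊤; ⊥⊆; ∉⊥; ∣⊥∣≡0; p─q⊆p; x∈p∧x∉q⇒x∈p─q)
open import Data.Vec using ([]; _∷_; here; there; lookup; replicate; _++_; take; drop)
open import Data.Vec.Properties using (lookup∘tabulate; []=⇒lookup; lookup⇒[]=; zipWith-++; take++drop≡id; ++-injective)
open import Data.List using (allFin)
open import Data.List.Relation.Unary.Any using (satisfied)
open import Data.List.Relation.Unary.Any.Properties using (any⁺; any⁻)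
open import Data.List.Membership.Propositional using (lose)
open import Data.List.Membership.Propositional.Properties using (∈-allFin)
open import Data.Product using (∃; _×_; _,_; proj₁)
open import Data.Empty using (⊥-elim)
open import Data.Sum using (inj₁; inj₂)
open import Function using (_∘_; _⇔_; mk⇔; Equivalence)
open import Relation.Nullary.Decidable using (does; dec-true; dec-false)
open import Relation.Binary.PropositionalEquality using (_≡_; refl; sym; trans; cong; cong₂; subst; module ≡-Reasoning)

x∈p─q⇒x∉q : ∀ {n} (p q : Subset n) {x} → x ∈ p ─ q → x ∉ q
x∈p─q⇒x∉q (inside ∷ p) (outside ∷ q) here ()
x∈p─q⇒x∉q (_ ∷ p) (_ ∷ q) (there x∈p─q) (there x∈q) = x∈p─q⇒x∉q p q x∈p─q x∈q

─-monoˡ-⊆ : ∀ {n} {p p′ : Subset n} (q : Subset n) → p ⊆ p′ → p ─ q ⊆ p′ ─ q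
─-monoˡ-⊆ {p = p} q p⊆p′ x∈p─q = x∈p∧x∉q⇒x∈p─q (p⊆p′ (p─q⊆p p q x∈p─q)) (x∈p─q⇒x∉q p q x∈p─q)

⊥─p≡⊥ : ∀ {n} (p : Subset n) → ⊥ ─ p ≡ ⊥
⊥─p≡⊥ p = ⊆-antisym (p─q⊆p ⊥ p) ⊥⊆

∈⇔T-lookup : ∀ {n} {p : Subset n} {x} → x ∈ p ⇔ T (lookup p x)
∈⇔T-lookup = mk⇔ (Equivalence.from T-≡ ∘ []=⇒lookup) (lookup⇒[]= _ _ ∘ Equivalence.to T-≡)

∣p++q∣≡∣p∣+∣q∣ : ∀ {m n} (p : Subset m) (q : Subset n) → ∣ p ++ q ∣ ≡ ∣ p ∣ + ∣ q ∣
∣p++q∣≡∣p∣+∣q∣ []            q = refl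
∣p++q∣≡∣p∣+∣q∣ (inside  ∷ p) q = cong suc (∣p++q∣≡∣p∣+∣q∣ p q)
∣p++q∣≡∣p∣+∣q∣ (outside ∷ p) q = ∣p++q∣≡∣p∣+∣q∣ p q

replicate-+ : ∀ {A : Set} m {n} (x : A) → replicate (m + n) x ≡ replicate m x ++ replicate n x
replicate-+ zero    x = refl
replicate-+ (suc m) x = cong (x ∷_) (replicate-+ m x)

∈-++⁺ˡ : ∀ {m n} {p : Subset m} {q : Subset n} {x} → x ∈ p → (x ↑ˡ n) ∈ p ++ q
∈-++⁺ˡ here        = here
∈-++⁺ˡ (there x∈p) = there (∈-++⁺ˡ x∈p)

∈-++⁻ˡ : ∀ {m n} (p : Subset m) {q : Subset n} {x} → (x ↑ˡ n) ∈ p ++ q → x ∈ p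
∈-++⁻ˡ (_ ∷ p) {x = zero}  here            = here
∈-++⁻ˡ (_ ∷ p) {x = suc x} (there x∈p++q) = there (∈-++⁻ˡ p x∈p++q)

∈-++⁺ʳ : ∀ {m n} (p : Subset m) {q : Subset n} {x} → x ∈ q → (m ↑ʳ x) ∈ p ++ q
∈-++⁺ʳ []      x∈q = x∈q
∈-++⁺ʳ (_ ∷ p) x∈q = there (∈-++⁺ʳ p x∈q)

∈-++⁻ʳ : ∀ {m n} (p : Subset m) {q : Subset n} {x} → (m ↑ʳ x) ∈ p ++ q → x ∈ q
∈-++⁻ʳ []      x∈p++q         = x∈p++q
∈-++⁻ʳ (_ ∷ p) (there x∈p++q) = ∈-++⁻ʳ p x∈p++q

module _ {n} (G : Adj n) where

  ∈-N⁺ : ∀ {A : Subset n} {v w} → w ∈ A → T (G v w) → v ∈ N G A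
  ∈-N⁺ {A} {v} {w} w∈A vw = Equivalence.from ∈⇔T-lookup
    (subst T (sym (lookup∘tabulate _ v))
      (any⁺ _ (lose (∈-allFin w) (Equivalence.from T-∧ (Equivalence.to ∈⇔T-lookup w∈A , vw)))))

  ∈-N⁻ : ∀ (A : Subset n) {v} → v ∈ N G A → ∃ λ w → w ∈ A × T (G v w)
  ∈-N⁻ A {v} v∈NA with satisfied (any⁻ _ (allFin n) (subst T (lookup∘tabulate _ v) (Equivalence.to ∈⇔T-lookup v∈NA)))
  ... | w , Aw∧vw with Equivalence.to T-∧ Aw∧vw
  ...   | Aw , vw = w , Equivalence.from ∈⇔T-lookup Aw , vw

  N-mono-⊆ : ∀ {A A′ : Subset n} → A ⊆ A′ → N G A ⊆ N G A′
  N-mono-⊆ {A} A⊆A′ v∈NA with ∈-N⁻ A v∈NA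
  ... | w , w∈A , vw = ∈-N⁺ (A⊆A′ w∈A) vw

  N-⊥ : N G ⊥ ≡ ⊥
  N-⊥ = ⊆-antisym (λ v∈N⊥ → let (_ , w∈⊥ , _) = ∈-N⁻ ⊥ v∈N⊥ in ⊥-elim (∉⊥ w∈⊥)) ⊥⊆

module _ {n} (G : Adj n) where

  Rabbit-cong≤ : ∀ {V W : Strategy n} u → (∀ t → t ≤ u → V t ≡ W t) → Rabbit G V u ≡ Rabbit G W u
  Rabbit-cong≤ zero    V≡W = cong (⊤ ─_) (V≡W 0 z≤n)
  Rabbit-cong≤ (suc u) V≡W = cong₂ (λ R S → N G R ─ S)
    (Rabbit-cong≤ u (λ t t≤u → V≡W t (m≤n⇒m≤1+n t≤u))) (V≡W (suc u) ≤-refl)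

  Rabbit-suc-⊆ : ∀ (V : Strategy n) u → Rabbit G V (suc u) ⊆ Rabbit G (V ∘ suc) u
  Rabbit-suc-⊆ V zero    = ─-monoˡ-⊆ (V 1) ⊆⊤
  Rabbit-suc-⊆ V (suc u) = ─-monoˡ-⊆ (V (suc (suc u))) (N-mono-⊆ G (Rabbit-suc-⊆ V u))

  Rabbit-+-⊆ : ∀ (V : Strategy n) d u → Rabbit G V (d + u) ⊆ Rabbit G (λ t → V (d + t)) u
  Rabbit-+-⊆ V zero    u = ⊆-refl
  Rabbit-+-⊆ V (suc d) u = ⊆-trans (Rabbit-suc-⊆ V (d + u)) (Rabbit-+-⊆ (V ∘ suc) d u)

  Rabbit-⊥-stable : ∀ {W : Strategy n} {t} → Rabbit G W t ≡ ⊥ → ∀ u → Rabbit G W (u + t) ≡ ⊥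
  Rabbit-⊥-stable R≡⊥ zero    = R≡⊥
  Rabbit-⊥-stable {W} {t} R≡⊥ (suc u) = begin
    N G (Rabbit G W (u + t)) ─ W (suc u + t)  ≡⟨ cong (λ R → N G R ─ W (suc u + t)) (Rabbit-⊥-stable R≡⊥ u) ⟩
    N G ⊥ ─ W (suc u + t)                     ≡⟨ cong (_─ W (suc u + t)) (N-⊥ G) ⟩
    ⊥ ─ W (suc u + t)                         ≡⟨ ⊥─p≡⊥ (W (suc u + t)) ⟩
    ⊥                                         ∎
    where open ≡-Reasoning

module _ {n} (G : Adj n) where

  data Copy : Fin (n + n) → Set where
    inV  : ∀ v → Copy (v ↑ˡ n)
    inV′ : ∀ v → Copy (n ↑ʳ v)

  copy : ∀ x → Copy x
  copy x with splitAt n x in eq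
  ... | inj₁ v rewrite sym (splitAt⁻¹-↑ˡ eq) = inV v
  ... | inj₂ v rewrite sym (splitAt⁻¹-↑ʳ eq) = inV′ v

  B-VV′ : ∀ v w → B G (v ↑ˡ n) (n ↑ʳ w) ≡ G v w
  B-VV′ v w rewrite splitAt-↑ˡ n v n | splitAt-↑ʳ n n w = refl

  B-V′V : ∀ v w → B G (n ↑ʳ v) (w ↑ˡ n) ≡ G v w
  B-V′V v w rewrite splitAt-↑ʳ n n v | splitAt-↑ˡ n w n = refl

  B-VV : ∀ v w → B G (v ↑ˡ n) (w ↑ˡ n) ≡ false
  B-VV v w rewrite splitAt-↑ˡ n v n | splitAt-↑ˡ n w n = refl

  B-V′V′ : ∀ v w → B G (n ↑ʳ v) (n ↑ʳ w) ≡ false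
  B-V′V′ v w rewrite splitAt-↑ʳ n n v | splitAt-↑ʳ n n w = refl

  N-B-++ : ∀ (p q : Subset n) → N (B G) (p ++ q) ≡ N G q ++ N G p
  N-B-++ p q = ⊆-antisym forward backward
    where
    forward : N (B G) (p ++ q) ⊆ N G q ++ N G p
    forward {x} x∈N with ∈-N⁻ (B G) (p ++ q) x∈N
    ... | y , y∈p++q , xy with copy x | copy y
    ... | inV v  | inV w  = ⊥-elim (subst T (B-VV v w) xy)
    ... | inV v  | inV′ w = ∈-++⁺ˡ (∈-N⁺ G (∈-++⁻ʳ p y∈p++q) (subst T (B-VV′ v w) xy))
    ... | inV′ v | inV w  = ∈-++⁺ʳ (N G q) (∈-N⁺ G (∈-++⁻ˡ p y∈p++q) (subst T (B-V′V v w) xy))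
    ... | inV′ v | inV′ w = ⊥-elim (subst T (B-V′V′ v w) xy)
    backward : N G q ++ N G p ⊆ N (B G) (p ++ q)
    backward {x} x∈ with copy x
    ... | inV v with ∈-N⁻ G q (∈-++⁻ˡ (N G q) x∈)
    ...   | w , w∈q , vw = ∈-N⁺ (B G) (∈-++⁺ʳ p w∈q) (subst T (sym (B-VV′ v w)) vw)
    backward {x} x∈ | inV′ v with ∈-N⁻ G p (∈-++⁻ʳ (N G q) x∈)
    ...   | w , w∈p , vw = ∈-N⁺ (B G) (∈-++⁺ˡ w∈p) (subst T (sym (B-V′V v w)) vw)

  pair : Bool → Subset n → Subset n → Subset (n + n)
  pair true  p q = p ++ q
  pair false p q = q ++ p

  restrict : Bool → Subset (n + n) → Subset n
  restrict true  X = take n X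
  restrict false X = drop n X

  pair-restrict : ∀ s X → pair s (restrict s X) (restrict (not s) X) ≡ X
  pair-restrict true  X = take++drop≡id n X
  pair-restrict false X = take++drop≡id n X

  pair-injective : ∀ s {p p′ q q′} → pair s p q ≡ pair s p′ q′ → p ≡ p′ × q ≡ q′
  pair-injective true  eq = ++-injective _ _ eq
  pair-injective false eq = let (q≡q′ , p≡p′) = ++-injective _ _ eq in p≡p′ , q≡q′

  pair-replicate : ∀ s x → replicate (n + n) x ≡ pair s (replicate n x) (replicate n x)
  pair-replicate true  x = replicate-+ n x
  pair-replicate false x = replicate-+ n x

  pair-─ : ∀ s p q p′ q′ → pair s p q ─ pair s p′ q′ ≡ pair s (p ─ p′) (q ─ q′)
  pair-─ true  p q p′ q′ = zipWith-++ _ p q p′ q′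
  pair-─ false p q p′ q′ = zipWith-++ _ q p q′ p′

  N-B-pair : ∀ s p q → N (B G) (pair s p q) ≡ pair (not s) (N G p) (N G q)
  N-B-pair true  p q = N-B-++ p q
  N-B-pair false p q = N-B-++ q p

  ∣pair∣ : ∀ s p q → ∣ pair s p q ∣ ≡ ∣ p ∣ + ∣ q ∣
  ∣pair∣ true  p q = ∣p++q∣≡∣p∣+∣q∣ p q
  ∣pair∣ false p q = trans (∣p++q∣≡∣p∣+∣q∣ q p) (+-comm ∣ q ∣ ∣ p ∣)

  ∣restrict∣≤∣∣ : ∀ s X → ∣ restrict s X ∣ ≤ ∣ X ∣
  ∣restrict∣≤∣∣ s X = subst (∣ restrict s X ∣ ≤_)
    (trans (sym (∣pair∣ s _ _)) (cong ∣_∣ (pair-restrict s X))) (m≤m+n _ _)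

  alternate : ℕ → Bool
  alternate zero    = true
  alternate (suc t) = not (alternate t)

  interleave : Strategy n → Strategy n → Strategy (n + n)
  interleave P Q t = pair (alternate t) (P t) (Q t)

  Rabbit-interleave : ∀ P Q t →
    Rabbit (B G) (interleave P Q) t ≡ pair (alternate t) (Rabbit G P t) (Rabbit G Q t)
  Rabbit-interleave P Q zero = begin
    ⊤ ─ pair true (P 0) (Q 0)              ≡⟨ cong (_─ pair true (P 0) (Q 0)) (pair-replicate true inside) ⟩
    pair true ⊤ ⊤ ─ pair true (P 0) (Q 0)  ≡⟨ pair-─ true ⊤ ⊤ (P 0) (Q 0) ⟩
    pair true (⊤ ─ P 0) (⊤ ─ Q 0)          ∎
    where open ≡-Reasoning
  Rabbit-interleave P Q (suc t) = begin
    N (B G) (Rabbit (B G) (interleave P Q) t) ─ interleave P Q (suc t)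
      ≡⟨ cong (λ R → N (B G) R ─ interleave P Q (suc t)) (Rabbit-interleave P Q t) ⟩
    N (B G) (pair a (Rabbit G P t) (Rabbit G Q t)) ─ pair (not a) (P (suc t)) (Q (suc t))
      ≡⟨ cong (_─ pair (not a) (P (suc t)) (Q (suc t))) (N-B-pair a (Rabbit G P t) (Rabbit G Q t)) ⟩
    pair (not a) (N G (Rabbit G P t)) (N G (Rabbit G Q t)) ─ pair (not a) (P (suc t)) (Q (suc t))
      ≡⟨ pair-─ (not a) _ _ _ _ ⟩
    pair (not a) (Rabbit G P (suc t)) (Rabbit G Q (suc t))
      ∎
    where
    open ≡-Reasoning
    a : Bool
    a = alternate t

  componentV componentV′ : Strategy (n + n) → Strategy n
  componentV  W t = restrict (alternate t) (W t)
  componentV′ W t = restrict (not (alternate t)) (W t)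

  interleave-components : ∀ W t → interleave (componentV W) (componentV′ W) t ≡ W t
  interleave-components W t = pair-restrict (alternate t) (W t)

  ∣interleave∣ : ∀ P Q t → ∣ interleave P Q t ∣ ≡ ∣ P t ∣ + ∣ Q t ∣
  ∣interleave∣ P Q t = ∣pair∣ (alternate t) (P t) (Q t)

  Huntable-B⇒Huntable : ∀ k → Huntable (B G) k → Huntable G k
  Huntable-B⇒Huntable k (W , bounded , τ , R≡⊥) =
    componentV W , (λ t → ≤-trans (∣restrict∣≤∣∣ (alternate t) (W t)) (bounded t)) ,
    τ , proj₁ (pair-injective (alternate τ) territory)
    where
    territory : pair (alternate τ) (Rabbit G (componentV W) τ) (Rabbit G (componentV′ W) τ) ≡ pair (alternate τ) ⊥ ⊥
    territory = begin
      pair (alternate τ) (Rabbit G (componentV W) τ) (Rabbit G (componentV′ W) τ)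
        ≡⟨ Rabbit-interleave (componentV W) (componentV′ W) τ ⟨
      Rabbit (B G) (interleave (componentV W) (componentV′ W)) τ
        ≡⟨ Rabbit-cong≤ (B G) τ (λ t _ → interleave-components W t) ⟩
      Rabbit (B G) W τ
        ≡⟨ R≡⊥ ⟩
      ⊥
        ≡⟨ pair-replicate (alternate τ) outside ⟩
      pair (alternate τ) ⊥ ⊥
        ∎
      where open ≡-Reasoning

  Huntable⇒Huntable-B : ∀ k → Huntable G k → Huntable (B G) k
  Huntable⇒Huntable-B k (W , bounded , τ , R≡⊥) = interleave first second , bounded′ , suc τ + τ , cleared
    where
    first second : Strategy n
    first  t = if does (t ≤? τ) then W t else ⊥
    second t = if does (t ≤? τ) then ⊥ else W (t ∸ suc τ)

    first-agrees : ∀ t → t ≤ τ → first t ≡ W t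
    first-agrees t t≤τ rewrite dec-true (t ≤? τ) t≤τ = refl

    second-delayed : ∀ t → second (suc τ + t) ≡ W t
    second-delayed t rewrite dec-false (suc τ + t ≤? τ) (<⇒≱ (s≤s (m≤m+n τ t))) | m+n∸m≡n (suc τ) t = refl

    bounded′ : Bounded k (interleave first second)
    bounded′ t rewrite ∣interleave∣ first second t with does (t ≤? τ)
    ... | true  rewrite ∣⊥∣≡0 n | +-identityʳ ∣ W t ∣ = bounded t
    ... | false rewrite ∣⊥∣≡0 n = bounded (t ∸ suc τ)

    first-cleared : Rabbit G first (suc τ + τ) ≡ ⊥
    first-cleared = Rabbit-⊥-stable G (trans (Rabbit-cong≤ G τ first-agrees) R≡⊥) (suc τ)

    second-cleared : Rabbit G second (suc τ + τ) ≡ ⊥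
    second-cleared = ⊆-antisym
      (⊆-trans (Rabbit-+-⊆ G second (suc τ) τ)
               (⊆-reflexive (trans (Rabbit-cong≤ G τ (λ t _ → second-delayed t)) R≡⊥)))
      ⊥⊆

    cleared : Rabbit (B G) (interleave first second) (suc τ + τ) ≡ ⊥
    cleared = begin
      Rabbit (B G) (interleave first second) (suc τ + τ)
        ≡⟨ Rabbit-interleave first second (suc τ + τ) ⟩
      pair a (Rabbit G first (suc τ + τ)) (Rabbit G second (suc τ + τ))
        ≡⟨ cong₂ (pair a) first-cleared second-cleared ⟩
      pair a ⊥ ⊥
        ≡⟨ pair-replicate a outside ⟨
      ⊥
        ∎
      where
      open ≡-Reasoning
      a : Bool
      a = alternate (suc τ + τ)

  Huntable⇔Huntable-B : ∀ k → Huntable G k ⇔ Huntable (B G) k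
  Huntable⇔Huntable-B k = mk⇔ (Huntable⇒Huntable-B k) (Huntable-B⇒Huntable k)

IsHuntingNumber-cong : ∀ {m n} {G : Adj m} {H : Adj n} → (∀ k → Huntable G k ⇔ Huntable H k) →
                       ∀ k → IsHuntingNumber G k ⇔ IsHuntingNumber H k
IsHuntingNumber-cong G⇔H k = mk⇔
  (λ (huntable , minimal) → Equivalence.to (G⇔H k) huntable , λ j j<k → minimal j j<k ∘ Equivalence.from (G⇔H j))
  (λ (huntable , minimal) → Equivalence.from (G⇔H k) huntable , λ j j<k → minimal j j<k ∘ Equivalence.to (G⇔H j))

lemma2 : ∀ (n : ℕ) (G : Adj n) → IsGraph G →
    ∀ (k : ℕ) → IsHuntingNumber G k ⇔ IsHuntingNumber (B G) k
lemma2 n G _ = IsHuntingNumber-cong (Huntable⇔Huntable-B G)
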